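{- Let $d\geq2$ and $n\geq3$. Let $p$ be a prime and $r\geq1$. For $e\in\{0,\dots,r\}$ and $\mathbf{a}\in\mathfrak{R}^{(e)}_{N_{d,n}}(p^r)$, we have $$\sigma(\mathbf{a};p^r)\geq\frac{1}{p^{(e+1)n}}.$$
   Context: $N_{d,n}=\binom{n+d}{d}$ and $\nu_{d,n}$ maps $(x_0,\dots,x_n)$ to the list of all degree $d$ monomials (coefficient $1$) in lexicographic order. For $\mathbf{a}\in(\mathbb{Z}/Q\mathbb{Z})^{N_{d,n}}$ let $f_{\mathbf{a}}$ be the degree $d$ form in $n+1$ variables with coefficient vector $\mathbf{a}$, i.e. $f_{\mathbf{a}}(\mathbf{x})=\langle\mathbf{a},\nu_{d,n}(\mathbf{x})\rangle$. For $Q,N\geq1$, $\mathfrak{R}_N(Q)=\{\mathbf{b}\in(\mathbb{Z}/Q\mathbb{Z})^N:\gcd(Q,b_1,\dots,b_N)=1\}$, and $\sigma(\mathbf{a};Q)=Q^{ -n}\#\{\mathbf{b}\in\mathfrak{R}_{n+1}(Q):f_{\mathbf{a}}(\mathbf{b})\equiv0\bmod Q\}$. For $\mathbf{v}\in(\mathbb{Z}/p^r\mathbb{Z})^N$, $v_p(\mathbf{v})$ is the largest $e\in\{0,\dots,r\}$ with $\mathbf{v}\equiv\mathbf{0}\bmod p^e$. For $e\in\{0,\dots,r\}$, $\mathfrak{R}^{(e)}_{N_{d,n}}(p^r)$ is the set of $\mathbf{a}\in\mathfrak{R}_{N_{d,n}}(p^r)$ for which there exists $\mathbf{x}\in\mathfrak{R}_{n+1}(p^r)$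 with $f_{\mathbf{a}}(\mathbf{x})\equiv0\bmod p^r$ and $v_p(\nabla f_{\mathbf{a}}(\mathbf{x}))=e$. -}

module Defs where

open import Data.Nat using (ℕ; zero; suc; _+_; _*_; _∸_; _^_; _≤_; _<_; NonZero)
open import Data.Nat.Properties using (m^n≢0)
open import Data.Nat.GCD using (gcd)
open import Data.Nat.Divisibility using (_∣_; _∣?_)
open import Data.Nat.Primality using (Prime; prime⇒nonZero)
open import Data.Nat.Combinatorics using (_C_)
open import Data.Fin using (Fin; toℕ)
open import Data.Vec using (Vec; []; _∷_; toList)
open import Data.Vec.Relation.Unary.All using (All)
open import Data.Nat.ListAction using (sum)
open import Data.List as L using (List; []; _∷_; zipWith; filter; length; concatMap; downFrom; allFin)
open import Data.Product using (_×_; ∃-syntax)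
open import Data.Integer using (+_)
open import Data.Rational using (ℚ; _/_)
open import Relation.Binary.PropositionalEquality using (_≡_)
open import Relation.Nullary using (¬_; Dec)
open import Relation.Nullary.Decidable using (_×-dec_)
open import Data.Nat using (_≟_)

N : ℕ → ℕ → ℕ
N d n = (n + d) C d

-- Exponent vectors of all monomials of degree d in k variables x_0,...,x_{k-1},
-- in lexicographic order (x_0 > x_1 > ... ; first monomial is x_0^d).
monos : (d k : ℕ) → List (Vec ℕ k)
monos zero    zero    = [] ∷ []
monos (suc d) zero    = []
monos d       (suc k) = concatMap (λ e0 → L.map (e0 ∷_) (monos (d ∸ e0) k)) (L.map (λ i → d ∸ i) (L.upTo (suc d)))

evalMono : ∀ {k} → Vec ℕ k → Vec ℕ k → ℕ
evalMono []       []       = 1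
evalMono (e ∷ es) (x ∷ xs) = x ^ e * evalMono es xs

-- ν_{d,n}(x) : list of all degree d monomials (coefficient 1), lex order
ν : (d n : ℕ) → Vec ℕ (suc n) → List ℕ
ν d n x = L.map (λ m → evalMono m x) (monos d (suc n))

rep : ∀ {Q k} → Vec (Fin Q) k → Vec ℕ k
rep = Data.Vec.map toℕ

-- f_a(x) = <a, ν_{d,n}(x)>, computed on representatives in ℕ (to be read mod Q)
form : ∀ {Q} (d n : ℕ) → Vec (Fin Q) (N d n) → Vec ℕ (suc n) → ℕ
form d n a x = sum (zipWith _*_ (toList (rep a)) (ν d n x))

dMono : ∀ {k} → Fin k → Vec ℕ k → Vec ℕ k → ℕ
dMono Fin.zero    (e ∷ es) (x ∷ xs) = e * (x ^ (e ∸ 1) * evalMono es xs)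
dMono (Fin.suc j) (e ∷ es) (x ∷ xs) = x ^ e * dMono j es xs

grad : ∀ {Q} (d n : ℕ) → Vec (Fin Q) (N d n) → Vec ℕ (suc n) → Vec ℕ (suc n)
grad d n a x = Data.Vec.tabulate λ j →
  sum (zipWith _*_ (toList (rep a)) (L.map (λ m → dMono j m x) (monos d (suc n))))

InR : ∀ {Q K} → Vec (Fin Q) K → Set
InR {Q} b = L.foldr gcd Q (toList (rep b)) ≡ 1

InR? : ∀ {Q K} (b : Vec (Fin Q) K) → Dec (InR b)
InR? {Q} b = L.foldr gcd Q (toList (rep b)) ≟ 1

allVecs : (Q k : ℕ) → List (Vec (Fin Q) k)
allVecs Q zero    = [] ∷ []
allVecs Q (suc k) = concatMap (λ i → L.map (i ∷_) (allVecs Q k)) (allFin Q)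

σ : (Q : ℕ) .{{_ : NonZero Q}} (d n : ℕ) → Vec (Fin Q) (N d n) → ℚ
σ Q {{nz}} d n a =
  ((+ length (filter (λ b → InR? b ×-dec (Q ∣? form d n a (rep b))) (allVecs Q (suc n))))
  / (Q ^ n)) {{m^n≢0 Q n {{nz}}}}

-- v_p(v) = e for v ∈ (Z/p^r)^K (given by representatives): e is the largest
-- element of {0,...,r} with v ≡ 0 mod p^e
HasVp : (p r : ℕ) → ∀ {K} → Vec ℕ K → ℕ → Set
HasVp p r v e = (e ≤ r) × All (λ c → (p ^ e) ∣ c) v
              × (e < r → ¬ All (λ c → (p ^ suc e) ∣ c) v)

InRe : (p r e d n : ℕ) → Vec (Fin (p ^ r)) (N d n) → Set
InRe p r e d n a = InR a × ∃[ x ] (InR {p ^ r} {suc n} x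
                                  × (p ^ r) ∣ form d n a (rep x)
                                  × HasVp p r (grad d n a (rep x)) e)

powNZ : ∀ {p} → Prime p → (k : ℕ) → NonZero (p ^ k)
powNZ {p} pp k = m^n≢0 p k {{prime⇒nonZero pp}}

-- Let x be a primitive zero of f = f_a modulo p^r with v_p(∇f(x)) = e.  If e = r, the zero x
-- alone gives σ ≥ p^(-rn).  If e < r, choose j₀ with p^(e+1) ∤ ∂_{j₀} f(x) and put q = p^(e+1).
-- By Taylor expansion every point x + q·w is a zero of f modulo p^(2e+1) (or p^r, if smaller),
-- and ∂_{j₀} f stays exactly divisible by p^e on it; so moving only the coordinate j₀ by a
-- suitable multiple of q·p^t gains one more power of p at each step (Hensel's lemma).  The other
-- n coordinates can be prescribed freely modulo p^r within their classes modulo q, which gives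
-- p^((r-e-1)n) distinct zeros, all primitive because they are congruent to x modulo p.
-- Hence σ ≥ p^((r-e-1)n) / p^(rn).
module Submission where

open import Defs
open import Data.Nat using (ℕ; suc; _*_; _^_; _≤_)
open import Data.Nat.Primality using (Prime)
open import Data.Fin using (Fin)
open import Data.Vec using (Vec)
open import Data.Integer using (+_)
open import Data.Rational using (ℚ; _/_; _≥_)

open import Data.Nat using (zero; _+_; _∸_; _<_; z≤n; s≤s; NonZero; _%_; nonTrivial⇒≢1)
open import Data.Nat.Properties
open import Data.Nat.DivMod using (_div_; _mod_; m≡m%n+[m/n]*n; [m+n]%n≡m%n; m<n⇒m%n≡m; m%n<n;
  +-distrib-/-∣ʳ; m<n⇒m/n≡0; m*n/n≡m; m<n*o⇒m/o<n)
open import Data.Nat.Divisibility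
open import Data.Nat.GCD using (gcd; gcd[m,n]∣m; gcd[m,n]∣n; gcd-greatest; module Bézout)
open import Data.Nat.Coprimality using (Coprime; coprime-Bézout; coprime-divisor; gcd≡1⇒coprime)
open import Data.Nat.Primality using (prime⇒irreducible; prime⇒nonZero; prime⇒nonTrivial; ¬prime[0])
open import Data.Nat.ListAction using (sum)
open import Data.Nat.Tactic.RingSolver using (solve-∀)
open import Algebra.Properties.Semiring.Sum +-*-semiring
  using (sum-syntax; ∑-distrib-+; *-distribˡ-sum; sum-cong-≗; sum-replicate-zero)
open import Data.Fin using (zero; suc; toℕ; punchIn)
open import Data.Fin.Properties using (punchInᵢ≢i; injective⇒≤; toℕ<n; toℕ-fromℕ<; toℕ-injective; ¬∀⟶∃¬)
open import Data.Vec as Vec using ([]; _∷_; lookup; tabulate; insertAt; zipWith; toList; _[_]≔_)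
open import Data.Vec.Properties using (lookup∘tabulate; tabulate∘lookup; tabulate-cong; lookup-replicate;
  lookup-map; lookup-zipWith; lookup∘updateAt′; insertAt-punchIn; map-∘; map-cong; ∷-injective)
open import Data.Vec.Relation.Unary.All using (All; []; _∷_)
open import Data.Vec.Relation.Unary.All.Properties using (lookup⁺; lookup⁻)
open import Data.List as List using (List; []; _∷_; length; filter; allFin; cartesianProductWith)
open import Data.List.Properties using (length-map; length-++; length-tabulate)
open import Data.List.Relation.Unary.Any using (here; index)
import Data.List.Relation.Unary.All as ListAll
open import Data.List.Relation.Unary.AllPairs using ([]; _∷_)
open import Data.List.Relation.Unary.Unique.Propositional using (Unique)
import Data.List.Relation.Unary.Unique.Propositional.Properties as Unique
open import Data.List.Membership.Propositional using (_∈_)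
open import Data.List.Membership.Propositional.Properties
  using (∈-filter⁺; ∈-lookup; ∈-allFin; ∈-cartesianProductWith⁺; ∈-map⁻)
open import Data.List.Membership.Setoid.Properties using (index-injective)
import Data.Integer as ℤ
import Data.Integer.Properties as ℤ
import Data.Rational as ℚ
open import Data.Rational.Properties using (toℚᵘ-cancel-≤; toℚᵘ-fromℚᵘ)
open import Data.Rational.Unnormalised using (mkℚᵘ; *≤*)
import Data.Rational.Unnormalised.Properties as ℚᵘ
open import Data.Product using (∃-syntax; _,_; _×_; proj₁; proj₂)
open import Data.Sum using (_⊎_; inj₁; inj₂; [_,_]′)
import Data.Sum as Sum
open import Data.Unit using (⊤)
open import Data.Empty using (⊥-elim)
open import Function using (_∘_; _⇔_; mk⇔; Equivalence)
open import Relation.Nullary using (¬_)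
open import Relation.Nullary.Decidable using (_×-dec_)
open import Relation.Unary using (Decidable)
open import Relation.Binary.PropositionalEquality

-- Taylor expansion

record Expansion (h a b l : ℕ) : Set where
  constructor expansion
  field
    R  : ℕ
    eq : a ≡ b + h * l + h * h * R

-- a ≡ b modulo h, in the one-sided form available in ℕ.
record Shift (h a b : ℕ) : Set where
  constructor shift
  field
    S  : ℕ
    eq : a ≡ b + h * S

module _ {h : ℕ} where

  expansion-const : ∀ c → Expansion h c c 0
  expansion-const c = expansion 0 (identity c h)
    where identity : ∀ c h → c ≡ c + h * 0 + h * h * 0
          identity = solve-∀

  expansion-step : ∀ x w → Expansion h (x + h * w) x w
  expansion-step x w = expansion 0 (identity x w h)
    where identity : ∀ x w h → x + h * w ≡ x + h * w + h * h * 0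
          identity = solve-∀

  expansion-respects : ∀ {a b l l′} → l ≡ l′ → Expansion h a b l → Expansion h a b l′
  expansion-respects refl ex = ex

  expansion-+ : ∀ {a b l a′ b′ l′} → Expansion h a b l → Expansion h a′ b′ l′ →
                Expansion h (a + a′) (b + b′) (l + l′)
  expansion-+ {b = b} {l} {b′ = b′} {l′} (expansion R refl) (expansion R′ refl) =
    expansion (R + R′) (identity b l R b′ l′ R′ h)
    where identity : ∀ b l R b′ l′ R′ h → b + h * l + h * h * R + (b′ + h * l′ + h * h * R′)
                       ≡ b + b′ + h * (l + l′) + h * h * (R + R′)
          identity = solve-∀

  expansion-* : ∀ {a b l a′ b′ l′} → Expansion h a b l → Expansion h a′ b′ l′ →
                Expansion h (a * a′) (b * b′) (l * b′ + b * l′)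
  expansion-* {b = b} {l} {b′ = b′} {l′} (expansion R refl) (expansion R′ refl) =
    expansion (l * l′ + R * b′ + b * R′ + h * (l * R′ + R * l′) + h * h * R * R′) (identity b l R b′ l′ R′ h)
    where identity : ∀ b l R b′ l′ R′ h → (b + h * l + h * h * R) * (b′ + h * l′ + h * h * R′)
                       ≡ b * b′ + h * (l * b′ + b * l′)
                         + h * h * (l * l′ + R * b′ + b * R′ + h * (l * R′ + R * l′) + h * h * R * R′)
          identity = solve-∀

  expansion-^ : ∀ {a b l} → Expansion h a b l → ∀ e → Expansion h (a ^ e) (b ^ e) (e * l * b ^ (e ∸ 1))
  expansion-^ ex zero = expansion-const 1
  expansion-^ {b = b} {l} ex (suc e) = expansion-respects (power-rule e) (expansion-* ex (expansion-^ ex e))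
    where
    power-rule : ∀ e → l * b ^ e + b * (e * l * b ^ (e ∸ 1)) ≡ suc e * l * b ^ e
    power-rule zero = identity l b
      where identity : ∀ l b → l * 1 + b * 0 ≡ 1 * l * 1
            identity = solve-∀
    power-rule (suc e) = identity l b (b ^ e) e
      where identity : ∀ l b B e → l * (b * B) + b * (suc e * l * B) ≡ suc (suc e) * l * (b * B)
            identity = solve-∀

  expansion⇒shift : ∀ {a b l} → Expansion h a b l → Shift h a b
  expansion⇒shift {b = b} {l} (expansion R refl) = shift (l + h * R) (identity b l R h)
    where identity : ∀ b l R h → b + h * l + h * h * R ≡ b + h * (l + h * R)
          identity = solve-∀

  shift⇒expansion : ∀ {a b} (s : Shift h a b) → Expansion h a b (Shift.S s)
  shift⇒expansion {b = b} (shift S refl) = expansion 0 (identity b S h)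
    where identity : ∀ b S h → b + h * S ≡ b + h * S + h * h * 0
          identity = solve-∀

shift-∣⇒ : ∀ {h a b d} → Shift h a b → d ∣ h → d ∣ b → d ∣ a
shift-∣⇒ (shift S refl) d∣h d∣b = ∣m∣n⇒∣m+n d∣b (∣m⇒∣m*n S d∣h)

shift-∣⇐ : ∀ {h a b d} → Shift h a b → d ∣ h → d ∣ a → d ∣ b
shift-∣⇐ {b = b} {d} (shift S refl) d∣h d∣a =
  ∣m+n∣m⇒∣n (subst (d ∣_) (+-comm b _) d∣a) (∣m⇒∣m*n S d∣h)

infixl 6 _+ᵥ_
infixl 7 _*ᵥ_

_+ᵥ_ : ∀ {k} → Vec ℕ k → Vec ℕ k → Vec ℕ k
_+ᵥ_ = zipWith _+_

_*ᵥ_ : ∀ {k} → ℕ → Vec ℕ k → Vec ℕ k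
h *ᵥ w = Vec.map (h *_) w

unit : ∀ {k} → Fin k → ℕ → Vec ℕ k
unit j c = Vec.replicate _ 0 [ j ]≔ c

lookup-unit-≢ : ∀ {k} {i j : Fin k} c → i ≢ j → lookup (unit j c) i ≡ 0
lookup-unit-≢ {k} {i} {j} c i≢j = trans (lookup∘updateAt′ i j i≢j (Vec.replicate k 0)) (lookup-replicate i 0)

lookup-+ᵥ-*ᵥ-unit : ∀ {k} {i j : Fin k} {W T c} → i ≢ j → lookup (W +ᵥ T *ᵥ unit j c) i ≡ lookup W i
lookup-+ᵥ-*ᵥ-unit {i = i} {j} {W} {T} {c} i≢j = begin
  lookup (W +ᵥ T *ᵥ unit j c) i          ≡⟨ lookup-zipWith _+_ i W _ ⟩
  lookup W i + lookup (T *ᵥ unit j c) i  ≡⟨ cong (λ t → lookup W i + t) (lookup-map i (T *_) (unit j c)) ⟩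
  lookup W i + T * lookup (unit j c) i   ≡⟨ cong (λ t → lookup W i + T * t) (lookup-unit-≢ c i≢j) ⟩
  lookup W i + T * 0                     ≡⟨ cong (λ t → lookup W i + t) (*-zeroʳ T) ⟩
  lookup W i + 0                         ≡⟨ +-identityʳ _ ⟩
  lookup W i                             ∎
  where open ≡-Reasoning

+ᵥ-*ᵥ-assoc : ∀ {k} q T (x W v : Vec ℕ k) → x +ᵥ q *ᵥ W +ᵥ (q * T) *ᵥ v ≡ x +ᵥ q *ᵥ (W +ᵥ T *ᵥ v)
+ᵥ-*ᵥ-assoc q T [] [] [] = refl
+ᵥ-*ᵥ-assoc q T (x ∷ xs) (w ∷ ws) (v ∷ vs) = cong₂ _∷_ (identity x q w T v) (+ᵥ-*ᵥ-assoc q T xs ws vs)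
  where identity : ∀ x q w T v → x + q * w + q * T * v ≡ x + q * (w + T * v)
        identity = solve-∀

∑-unit : ∀ {k} (j : Fin k) c (g : Fin k → ℕ) → ∑[ i < k ] (lookup (unit j c) i * g i) ≡ c * g j
∑-unit {suc k} zero c g = begin
  c * g zero + ∑[ i < k ] (lookup (Vec.replicate k 0) i * g (suc i))
    ≡⟨ cong (λ t → c * g zero + t) (trans (sum-cong-≗ (λ i → cong (_* g (suc i)) (lookup-replicate i 0)))
                                          (sum-replicate-zero k)) ⟩
  c * g zero + 0 ≡⟨ +-identityʳ _ ⟩
  c * g zero     ∎
  where open ≡-Reasoning
∑-unit {suc k} (suc j) c g = ∑-unit j c (g ∘ suc)

∑-∣ : ∀ {d k} (g : Fin k → ℕ) → (∀ j → d ∣ g j) → d ∣ ∑[ j < k ] g j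
∑-∣ {k = zero}  g d∣g = _ ∣0
∑-∣ {k = suc k} g d∣g = ∣m∣n⇒∣m+n (d∣g zero) (∑-∣ (g ∘ suc) (d∣g ∘ suc))

evalMono-expansion : ∀ {k} h (es z w : Vec ℕ k) →
  Expansion h (evalMono es (z +ᵥ h *ᵥ w)) (evalMono es z) (∑[ j < k ] (lookup w j * dMono j es z))
evalMono-expansion h [] [] [] = expansion-const 1
evalMono-expansion {suc k} h (e ∷ es) (x ∷ xs) (w ∷ ws) =
  expansion-respects product-rule
    (expansion-* (expansion-^ (expansion-step x w) e) (evalMono-expansion h es xs ws))
  where
  X = x ^ (e ∸ 1)
  E = evalMono es xs
  product-rule : e * w * X * E + x ^ e * ∑[ j < k ] (lookup ws j * dMono j es xs)
               ≡ w * (e * (X * E)) + ∑[ j < k ] (lookup ws j * (x ^ e * dMono j es xs))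
  product-rule = cong₂ _+_ (regroup e w X E)
    (trans (*-distribˡ-sum (x ^ e) (λ j → lookup ws j * dMono j es xs))
           (sum-cong-≗ (λ j → swap (x ^ e) (lookup ws j) (dMono j es xs))))
    where
    regroup : ∀ e w X E → e * w * X * E ≡ w * (e * (X * E))
    regroup = solve-∀
    swap : ∀ a b c → a * (b * c) ≡ b * (a * c)
    swap = solve-∀

dMono-shift : ∀ {k} h (j : Fin k) (es z w : Vec ℕ k) → Shift h (dMono j es (z +ᵥ h *ᵥ w)) (dMono j es z)
dMono-shift h zero (e ∷ es) (x ∷ xs) (w ∷ ws) = expansion⇒shift
  (expansion-* (expansion-const e)
    (expansion-* (expansion-^ (expansion-step x w) (e ∸ 1)) (evalMono-expansion h es xs ws)))
dMono-shift h (suc j) (e ∷ es) (x ∷ xs) (w ∷ ws) = expansion⇒shift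
  (expansion-* (expansion-^ (expansion-step x w) e) (shift⇒expansion (dMono-shift h j es xs ws)))

combination : ∀ {A : Set} → List ℕ → List A → (A → ℕ) → ℕ
combination cs ms F = sum (List.zipWith _*_ cs (List.map F ms))

module _ {A : Set} where

  combination-expansion : ∀ {h} cs ms {F G L : A → ℕ} → (∀ m → Expansion h (F m) (G m) (L m)) →
    Expansion h (combination cs ms F) (combination cs ms G) (combination cs ms L)
  combination-expansion []       ms       ex = expansion-const 0
  combination-expansion (c ∷ cs) []       ex = expansion-const 0
  combination-expansion (c ∷ cs) (m ∷ ms) ex =
    expansion-+ (expansion-* (expansion-const c) (ex m)) (combination-expansion cs ms ex)

  combination-scale : ∀ cs ms c (F : A → ℕ) → combination cs ms (λ m → c * F m) ≡ c * combination cs ms F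
  combination-scale []        ms       c F = sym (*-zeroʳ c)
  combination-scale (c′ ∷ cs) []       c F = sym (*-zeroʳ c)
  combination-scale (c′ ∷ cs) (m ∷ ms) c F = begin
    c′ * (c * F m) + combination cs ms (λ m → c * F m)
      ≡⟨ cong (λ t → c′ * (c * F m) + t) (combination-scale cs ms c F) ⟩
    c′ * (c * F m) + c * combination cs ms F
      ≡⟨ identity c′ c (F m) _ ⟩
    c * (c′ * F m + combination cs ms F) ∎
    where
    open ≡-Reasoning
    identity : ∀ c′ c x y → c′ * (c * x) + c * y ≡ c * (c′ * x + y)
    identity = solve-∀

  combination-∑ : ∀ cs ms {k} (g : A → Fin k → ℕ) →
    combination cs ms (λ m → ∑[ j < k ] g m j) ≡ ∑[ j < k ] combination cs ms (λ m → g m j)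
  combination-∑ []       ms       {k} g = sym (sum-replicate-zero k)
  combination-∑ (c ∷ cs) []       {k} g = sym (sum-replicate-zero k)
  combination-∑ (c ∷ cs) (m ∷ ms) {k} g = begin
    c * ∑[ j < k ] g m j + combination cs ms (λ m → ∑[ j < k ] g m j)
      ≡⟨ cong₂ _+_ (*-distribˡ-sum c (g m)) (combination-∑ cs ms g) ⟩
    ∑[ j < k ] (c * g m j) + ∑[ j < k ] combination cs ms (λ m → g m j)
      ≡⟨ ∑-distrib-+ (λ j → c * g m j) _ ⟨
    ∑[ j < k ] (c * g m j + combination cs ms (λ m → g m j)) ∎
    where open ≡-Reasoning

^-monoʳ-∣ : ∀ p {m n} → m ≤ n → p ^ m ∣ p ^ n
^-monoʳ-∣ p {m} {n} m≤n = divides (p ^ (n ∸ m))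
  (trans (cong (p ^_) (sym (m+[n∸m]≡n m≤n))) (trans (^-distribˡ-+-* p m (n ∸ m)) (*-comm (p ^ m) _)))

∤-cofactor : ∀ {p e u x} → x ≡ u * p ^ e → ¬ p ^ suc e ∣ x → ¬ p ∣ u
∤-cofactor {p} {e} refl p^[1+e]∤x p∣u = p^[1+e]∤x (*-monoˡ-∣ (p ^ e) p∣u)

prime-∤⇒coprime : ∀ {p u} → Prime p → ¬ p ∣ u → Coprime p u
prime-∤⇒coprime p-prime p∤u (d∣p , d∣u) with prime⇒irreducible p-prime d∣p
... | inj₁ d≡1  = d≡1
... | inj₂ refl = ⊥-elim (p∤u d∣u)

linear-congruence : ∀ {p u} → Prime p → ¬ p ∣ u → ∀ A → ∃[ c ] p ∣ A + c * u
linear-congruence {zero} p-prime = ⊥-elim (¬prime[0] p-prime)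
linear-congruence {p@(suc p′)} {u} p-prime p∤u A with coprime-Bézout (prime-∤⇒coprime p-prime p∤u)
... | Bézout.+- x y 1+yu≡xp = A * y , divides (A * x) (begin
  A + A * y * u   ≡⟨ identity A y u ⟩
  A * (1 + y * u) ≡⟨ cong (A *_) 1+yu≡xp ⟩
  A * (x * p)     ≡⟨ *-assoc A x p ⟨
  A * x * p       ∎)
  where
  open ≡-Reasoning
  identity : ∀ A y u → A + A * y * u ≡ A * (1 + y * u)
  identity = solve-∀
... | Bézout.-+ x y 1+xp≡yu = A * p′ * y , divides (A + A * p′ * x) (begin
  A + A * p′ * y * u       ≡⟨ cong (λ t → A + t) (*-assoc (A * p′) y u) ⟩
  A + A * p′ * (y * u)     ≡⟨ cong (λ t → A + A * p′ * t) 1+xp≡yu ⟨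
  A + A * p′ * (1 + x * p) ≡⟨ identity A p′ x ⟩
  (A + A * p′ * x) * p     ∎)
  where
  open ≡-Reasoning
  identity : ∀ A p′ x → A + A * p′ * (1 + x * suc p′) ≡ (A + A * p′ * x) * suc p′
  identity = solve-∀

module _ (d n : ℕ) {Q} (a : Vec (Fin Q) (N d n)) where

  private
    f : Vec ℕ (suc n) → ℕ
    f = form d n a

    ∂[_] : Fin (suc n) → Vec ℕ (suc n) → ℕ
    ∂[ j ] z = lookup (grad d n a z) j

    coefficients : List ℕ
    coefficients = toList (rep a)

    monomials : List (Vec ℕ (suc n))
    monomials = monos d (suc n)

    combine : (Vec ℕ (suc n) → ℕ) → ℕ
    combine = combination coefficients monomials

  partial-combination : ∀ j z → ∂[ j ] z ≡ combine (λ m → dMono j m z)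
  partial-combination j z = lookup∘tabulate (λ j → combine (λ m → dMono j m z)) j

  form-expansion : ∀ h z w → Expansion h (f (z +ᵥ h *ᵥ w)) (f z) (∑[ j < suc n ] (lookup w j * ∂[ j ] z))
  form-expansion h z w = expansion-respects linear-term
    (combination-expansion coefficients monomials (λ m → evalMono-expansion h m z w))
    where
    linear-term : combine (λ m → ∑[ j < suc n ] (lookup w j * dMono j m z)) ≡ ∑[ j < suc n ] (lookup w j * ∂[ j ] z)
    linear-term = trans (combination-∑ coefficients monomials (λ m j → lookup w j * dMono j m z))
      (sum-cong-≗ λ j → trans (combination-scale coefficients monomials (lookup w j) (λ m → dMono j m z))
                              (cong (lookup w j *_) (sym (partial-combination j z))))

  form-expansion-along : ∀ h z j c → Expansion h (f (z +ᵥ h *ᵥ unit j c)) (f z) (c * ∂[ j ] z)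
  form-expansion-along h z j c = expansion-respects (∑-unit j c (λ i → ∂[ i ] z)) (form-expansion h z (unit j c))

  form-shift : ∀ h z w → Shift h (f (z +ᵥ h *ᵥ w)) (f z)
  form-shift h z w = expansion⇒shift (form-expansion h z w)

  partial-shift : ∀ h z w j → Shift h (∂[ j ] (z +ᵥ h *ᵥ w)) (∂[ j ] z)
  partial-shift h z w j rewrite partial-combination j (z +ᵥ h *ᵥ w) | partial-combination j z =
    expansion⇒shift (combination-expansion coefficients monomials (λ m → shift⇒expansion (dMono-shift h j m z w)))

  -- Hensel lifting

  module _ {p : ℕ} (p-prime : Prime p) where

    hensel-step : ∀ {e h z j} → p ^ suc e ∣ h → p ^ e * h ∣ f z →
                  p ^ e ∣ ∂[ j ] z → ¬ p ^ suc e ∣ ∂[ j ] z →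
                  ∃[ c ] p * (p ^ e * h) ∣ f (z +ᵥ h *ᵥ unit j c)
    hensel-step {e} {z = z} {j} (divides m refl) (divides A fz≡) (divides u ∂≡) p^[1+e]∤∂
      with linear-congruence p-prime (∤-cofactor {e = e} ∂≡ p^[1+e]∤∂) A
    ... | c , divides B A+cu≡Bp with form-expansion-along (m * p ^ suc e) z j c
    ... | expansion R fz′≡ = c , divides (B + m * R) (begin
      f (z +ᵥ h *ᵥ unit j c)                       ≡⟨ fz′≡ ⟩
      f z + h * (c * ∂[ j ] z) + h * h * R         ≡⟨ cong₂ (λ s t → s + h * (c * t) + h * h * R) fz≡ ∂≡ ⟩
      A * (P * h) + h * (c * (u * P)) + h * h * R  ≡⟨ identity A P c u p m R ⟩
      (A + c * u + m * R * p) * (P * h)            ≡⟨ cong (λ t → (t + m * R * p) * (P * h)) A+cu≡Bp ⟩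
      (B * p + m * R * p) * (P * h)                ≡⟨ identity′ B p m R (P * h) ⟩
      (B + m * R) * (p * (P * h))                  ∎)
      where
      open ≡-Reasoning
      P = p ^ e
      h = m * (p * P)
      identity : ∀ A P c u p m R →
        A * (P * (m * (p * P))) + m * (p * P) * (c * (u * P)) + m * (p * P) * (m * (p * P)) * R
        ≡ (A + c * u + m * R * p) * (P * (m * (p * P)))
      identity = solve-∀
      identity′ : ∀ B p m R X → (B * p + m * R * p) * X ≡ (B + m * R) * (p * X)
      identity′ = solve-∀

    module _ {r e : ℕ} {x : Vec ℕ (suc n)} (root : p ^ r ∣ f x) (p^e∣∂ : ∀ j → p ^ e ∣ ∂[ j ] x)
             {j₀ : Fin (suc n)} (p^[1+e]∤∂ : ¬ p ^ suc e ∣ ∂[ j₀ ] x) where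

      private
        q : ℕ
        q = p ^ suc e

        p^[2e+1]≡ : p ^ (e + suc e) ≡ p ^ e * q
        p^[2e+1]≡ = ^-distribˡ-+-* p e (suc e)

      translate-divisible : ∀ {d′} → d′ ∣ p ^ e * q → d′ ∣ f x → ∀ W → d′ ∣ f (x +ᵥ q *ᵥ W)
      translate-divisible {d′} d′∣D d′∣fx W with form-expansion q x W
      ... | expansion R eq = subst (d′ ∣_) (sym eq)
        (∣m∣n⇒∣m+n (∣m∣n⇒∣m+n d′∣fx (∣-trans d′∣D D∣qL)) (∣-trans d′∣D D∣qqR))
        where
        D = p ^ e * q
        L = ∑[ j < suc n ] (lookup W j * ∂[ j ] x)
        D∣qL : D ∣ q * L
        D∣qL = subst (_∣ q * L) (*-comm q (p ^ e)) (*-monoʳ-∣ q (∑-∣ _ (λ j → ∣n⇒∣m*n (lookup W j) (p^e∣∂ j))))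
        D∣qqR : D ∣ q * q * R
        D∣qqR = divides (p * R) (identity (p ^ e) p R)
          where identity : ∀ P p R → p * P * (p * P) * R ≡ p * R * (P * (p * P))
                identity = solve-∀

      -- p^r may be a smaller power than p^(2e+1), so the lift starts from the weaker of the two.
      translate-root : ∀ W → p ^ r ∣ f (x +ᵥ q *ᵥ W) ⊎ p ^ e * q ∣ f (x +ᵥ q *ᵥ W)
      translate-root W with ≤-total r (e + suc e)
      ... | inj₁ r≤2e+1 = inj₁ (translate-divisible (subst (p ^ r ∣_) p^[2e+1]≡ (^-monoʳ-∣ p r≤2e+1)) root W)
      ... | inj₂ 2e+1≤r = inj₂ (translate-divisible ∣-refl (∣-trans (subst (_∣ p ^ r) p^[2e+1]≡ (^-monoʳ-∣ p 2e+1≤r)) root) W)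

      translate-partial-∣ : ∀ W → p ^ e ∣ ∂[ j₀ ] (x +ᵥ q *ᵥ W)
      translate-partial-∣ W = shift-∣⇒ (partial-shift q x W j₀) (n∣m*n p) (p^e∣∂ j₀)

      translate-partial-∤ : ∀ W → ¬ p ^ suc e ∣ ∂[ j₀ ] (x +ᵥ q *ᵥ W)
      translate-partial-∤ W = p^[1+e]∤∂ ∘ shift-∣⇐ (partial-shift q x W j₀) ∣-refl

      refine : ∀ t W → p ^ e * (q * p ^ t) ∣ f (x +ᵥ q *ᵥ W) →
               ∃[ c ] p ^ e * (q * p ^ suc t) ∣ f (x +ᵥ q *ᵥ (W +ᵥ p ^ t *ᵥ unit j₀ c))
      refine t W approx with hensel-step {e = e} (∣m⇒∣m*n (p ^ t) ∣-refl) approx (translate-partial-∣ W) (translate-partial-∤ W)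
      ... | c , p∣ = c , subst₂ _∣_ (identity p (p ^ e) q (p ^ t)) (cong f (+ᵥ-*ᵥ-assoc q (p ^ t) x W (unit j₀ c))) p∣
        where identity : ∀ p P q T → p * (P * (q * T)) ≡ P * (q * (p * T))
              identity = solve-∀

      approximate-roots : (s : Fin n → ℕ) → ∀ t → ∃[ W ] (∀ i → lookup W (punchIn j₀ i) ≡ s i) ×
        (p ^ r ∣ f (x +ᵥ q *ᵥ W) ⊎ p ^ e * (q * p ^ t) ∣ f (x +ᵥ q *ᵥ W))
      approximate-roots s zero =
        W₀ , agrees₀ , Sum.map₂ (subst (_∣ f (x +ᵥ q *ᵥ W₀)) (cong (p ^ e *_) (sym (*-identityʳ q)))) (translate-root W₀)
        where
        W₀ : Vec ℕ (suc n)
        W₀ = insertAt (tabulate s) j₀ 0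
        agrees₀ : ∀ i → lookup W₀ (punchIn j₀ i) ≡ s i
        agrees₀ i = trans (insertAt-punchIn (tabulate s) j₀ 0 i) (lookup∘tabulate s i)
      approximate-roots s (suc t) with approximate-roots s t
      ... | W , agrees , inj₁ root′  = W , agrees , inj₁ root′
      ... | W , agrees , inj₂ approx with refine t W approx
      ...   | c , approx′ = W +ᵥ p ^ t *ᵥ unit j₀ c ,
              (λ i → trans (lookup-+ᵥ-*ᵥ-unit {W = W} {T = p ^ t} (punchInᵢ≢i j₀ i)) (agrees i)) , inj₂ approx′

      hensel-lift : (s : Fin n → ℕ) →
        ∃[ W ] (∀ i → lookup W (punchIn j₀ i) ≡ s i) × p ^ r ∣ f (x +ᵥ q *ᵥ W)
      hensel-lift s with approximate-roots s r
      ... | W , agrees , inj₁ root′  = W , agrees , root′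
      ... | W , agrees , inj₂ approx = W , agrees , ∣-trans (∣n⇒∣m*n (p ^ e) (n∣m*n q)) approx

-- Primitive vectors modulo p^r

∣-foldr-gcd⁻ : ∀ {d Q k} (v : Vec ℕ k) → d ∣ List.foldr gcd Q (toList v) → d ∣ Q × All (d ∣_) v
∣-foldr-gcd⁻ [] d∣Q = d∣Q , []
∣-foldr-gcd⁻ (x ∷ v) d∣ with ∣-foldr-gcd⁻ v (∣-trans d∣ (gcd[m,n]∣n x _))
... | d∣Q , d∣v = d∣Q , ∣-trans d∣ (gcd[m,n]∣m x _) ∷ d∣v

∣-foldr-gcd⁺ : ∀ {d Q k} (v : Vec ℕ k) → d ∣ Q → All (d ∣_) v → d ∣ List.foldr gcd Q (toList v)
∣-foldr-gcd⁺ [] d∣Q [] = d∣Q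
∣-foldr-gcd⁺ (x ∷ v) d∣Q (d∣x ∷ d∣v) = gcd-greatest d∣x (∣-foldr-gcd⁺ v d∣Q d∣v)

coprime-∣^⇒≡1 : ∀ {g p} → Coprime g p → ∀ r → g ∣ p ^ r → g ≡ 1
coprime-∣^⇒≡1 coprime zero    g∣1 = ∣1⇒≡1 g∣1
coprime-∣^⇒≡1 coprime (suc r) g∣  = coprime-∣^⇒≡1 coprime r (coprime-divisor coprime g∣)

∣prime^⇒≡1⊎prime∣ : ∀ {p g} → Prime p → ∀ r → g ∣ p ^ r → g ≡ 1 ⊎ p ∣ g
∣prime^⇒≡1⊎prime∣ {p} {g} p-prime r g∣ with prime⇒irreducible p-prime (gcd[m,n]∣n g p)
... | inj₁ gcd≡1 = inj₁ (coprime-∣^⇒≡1 (gcd≡1⇒coprime gcd≡1) r g∣)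
... | inj₂ gcd≡p = inj₂ (subst (_∣ g) gcd≡p (gcd[m,n]∣m g p))

primitive⇔ : ∀ {p r k} → Prime p → 1 ≤ r → (v : Vec ℕ k) →
             List.foldr gcd (p ^ r) (toList v) ≡ 1 ⇔ (¬ All (p ∣_) v)
primitive⇔ {p} {suc r} p-prime _ v = mk⇔ to from
  where
  g = List.foldr gcd (p ^ suc r) (toList v)
  to : g ≡ 1 → ¬ All (p ∣_) v
  to g≡1 p∣v = nonTrivial⇒≢1 {{prime⇒nonTrivial p-prime}}
    (∣1⇒≡1 (subst (p ∣_) g≡1 (∣-foldr-gcd⁺ v (m∣m*n (p ^ r)) p∣v)))
  from : ¬ All (p ∣_) v → g ≡ 1
  from p∤v with ∣prime^⇒≡1⊎prime∣ p-prime (suc r) (proj₁ (∣-foldr-gcd⁻ v ∣-refl))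
  ... | inj₁ g≡1 = g≡1
  ... | inj₂ p∣g = ⊥-elim (p∤v (proj₂ (∣-foldr-gcd⁻ v p∣g)))

All-∣-translate-mod : ∀ {p q M k} .{{_ : NonZero M}} → p ∣ q → p ∣ M → (x W : Vec ℕ k) →
  All (p ∣_) (Vec.map (_% M) (x +ᵥ q *ᵥ W)) → All (p ∣_) x
All-∣-translate-mod p∣q p∣M [] [] [] = []
All-∣-translate-mod p∣q p∣M (x ∷ xs) (w ∷ ws) (p∣y ∷ p∣ys) =
  shift-∣⇐ (shift w refl) p∣q (∣n∣m%n⇒∣m p∣M p∣y) ∷ All-∣-translate-mod p∣q p∣M xs ws p∣ys

-- Counting

module _ {A : Set} where

  unique-lookup-injective : ∀ {xs : List A} → Unique xs → ∀ i j → List.lookup xs i ≡ List.lookup xs j → i ≡ j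
  unique-lookup-injective (_ ∷ _)  zero    zero    _  = refl
  unique-lookup-injective (x∉ ∷ _) zero    (suc j) eq = ⊥-elim (ListAll.lookup x∉ (∈-lookup j) eq)
  unique-lookup-injective (x∉ ∷ _) (suc i) zero    eq = ⊥-elim (ListAll.lookup x∉ (∈-lookup i) (sym eq))
  unique-lookup-injective (_ ∷ u)  (suc i) (suc j) eq = cong suc (unique-lookup-injective u i j eq)

  unique-⊆⇒length-≤ : ∀ {xs ys : List A} → Unique xs → (∀ {x} → x ∈ xs → x ∈ ys) → length xs ≤ length ys
  unique-⊆⇒length-≤ {xs} unique xs⊆ys = injective⇒≤ {f = position} position-injective
    where
    position : Fin (length xs) → Fin _
    position i = index (xs⊆ys (∈-lookup i))
    position-injective : ∀ {i j} → position i ≡ position j → i ≡ j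
    position-injective {i} {j} eq = unique-lookup-injective unique i j
      (index-injective (setoid A) (xs⊆ys (∈-lookup i)) (xs⊆ys (∈-lookup j)) eq)

module _ {A B : Set} {P : B → Set} (P? : Decidable P) (g : A → B)
         (g-injective : ∀ {a a′} → g a ≡ g a′ → a ≡ a′) (g-sat : ∀ a → P (g a)) where

  injection-count : ∀ {xs : List A} → Unique xs → (ys : List B) → (∀ b → b ∈ ys) →
                    length xs ≤ length (filter P? ys)
  injection-count {xs} unique ys complete = ≤-trans (≤-reflexive (sym (length-map g xs)))
    (unique-⊆⇒length-≤ (Unique.map⁺ g-injective unique) image⊆)
    where
    image⊆ : ∀ {b} → b ∈ List.map g xs → b ∈ filter P? ys
    image⊆ b∈ with ∈-map⁻ g b∈
    ... | a , _ , refl = ∈-filter⁺ P? (complete (g a)) (g-sat a)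

allVecs-cartesian : ∀ Q k → allVecs Q (suc k) ≡ cartesianProductWith _∷_ (allFin Q) (allVecs Q k)
allVecs-cartesian Q k = go (allFin Q)
  where
  go : ∀ is → List.concatMap (λ i → List.map (i ∷_) (allVecs Q k)) is ≡ cartesianProductWith _∷_ is (allVecs Q k)
  go []       = refl
  go (i ∷ is) = cong (List.map (i ∷_) (allVecs Q k) List.++_) (go is)

allVecs-complete : ∀ Q {k} (v : Vec (Fin Q) k) → v ∈ allVecs Q k
allVecs-complete Q []               = here refl
allVecs-complete Q {suc k} (i ∷ v) = subst (_ ∈_) (sym (allVecs-cartesian Q k))
  (∈-cartesianProductWith⁺ _∷_ (∈-allFin i) (allVecs-complete Q v))

allVecs-unique : ∀ Q k → Unique (allVecs Q k)
allVecs-unique Q zero    = ListAll.[] ∷ []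
allVecs-unique Q (suc k) = subst Unique (sym (allVecs-cartesian Q k))
  (Unique.cartesianProductWith⁺ _∷_ ∷-injective (Unique.allFin⁺ Q) (allVecs-unique Q k))

length-cartesianProductWith : ∀ {A B C : Set} (h : A → B → C) xs ys →
  length (cartesianProductWith h xs ys) ≡ length xs * length ys
length-cartesianProductWith h []       ys = refl
length-cartesianProductWith h (x ∷ xs) ys = trans (length-++ (List.map (h x) ys))
  (cong₂ _+_ (length-map (h x) ys) (length-cartesianProductWith h xs ys))

length-allVecs : ∀ Q k → length (allVecs Q k) ≡ Q ^ k
length-allVecs Q zero    = refl
length-allVecs Q (suc k) = begin
  length (allVecs Q (suc k))                                    ≡⟨ cong length (allVecs-cartesian Q k) ⟩
  length (cartesianProductWith _∷_ (allFin Q) (allVecs Q k))    ≡⟨ length-cartesianProductWith _∷_ (allFin Q) _ ⟩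
  length (allFin Q) * length (allVecs Q k)                      ≡⟨ cong₂ _*_ (length-tabulate {n = Q} (λ i → i)) (length-allVecs Q k) ⟩
  Q * Q ^ k                                                     ∎
  where open ≡-Reasoning

offset : (q P x s : ℕ) .{{_ : NonZero q}} → ℕ
offset q P x s = P ∸ x div q + s

-- x + q · offset q P x s = x % q + q·s + q·P, so reducing modulo q·P and dividing by q recovers s.
offset-decode : ∀ q P M .{{_ : NonZero q}} .{{_ : NonZero M}} → q * P ≡ M → ∀ {x s} → x < M → s < P →
                ((x + q * offset q P x s) % M) div q ≡ s
offset-decode q P M qP≡M {x} {s} x<M s<P = begin
    ((x + q * (P ∸ k + s)) % M) div q ≡⟨ cong (λ v → (v % M) div q) unfold ⟩
    ((ρ + s * q + M) % M) div q       ≡⟨ cong (_div q) ([m+n]%n≡m%n (ρ + s * q) M) ⟩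
    ((ρ + s * q) % M) div q           ≡⟨ cong (_div q) (m<n⇒m%n≡m ρ+sq<M) ⟩
    (ρ + s * q) div q                 ≡⟨ +-distrib-/-∣ʳ ρ (n∣m*n s) ⟩
    ρ div q + s * q div q             ≡⟨ cong₂ _+_ (m<n⇒m/n≡0 (m%n<n x q)) (m*n/n≡m s q) ⟩
    s                                 ∎
  where
  open ≡-Reasoning
  k = x div q
  ρ = x % q
  k≤P : k ≤ P
  k≤P = <⇒≤ (m<n*o⇒m/o<n (subst (x <_) (trans (sym qP≡M) (*-comm q P)) x<M))
  unfold : x + q * (P ∸ k + s) ≡ ρ + s * q + M
  unfold = begin
    x + q * (P ∸ k + s)           ≡⟨ cong (_+ q * (P ∸ k + s)) (m≡m%n+[m/n]*n x q) ⟩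
    ρ + k * q + q * (P ∸ k + s)   ≡⟨ identity ρ k q (P ∸ k) s ⟩
    ρ + s * q + q * (k + (P ∸ k)) ≡⟨ cong (λ v → ρ + s * q + q * v) (m+[n∸m]≡n k≤P) ⟩
    ρ + s * q + q * P             ≡⟨ cong (λ v → ρ + s * q + v) qP≡M ⟩
    ρ + s * q + M                 ∎
    where identity : ∀ ρ k q j s → ρ + k * q + q * (j + s) ≡ ρ + s * q + q * (k + j)
          identity = solve-∀
  ρ+sq<M : ρ + s * q < M
  ρ+sq<M = <-≤-trans (+-monoˡ-< (s * q) (m%n<n x q))
                     (≤-trans (*-monoˡ-≤ q s<P) (≤-reflexive (trans (*-comm P q) qP≡M)))

rep-mod : ∀ M .{{_ : NonZero M}} {k} (y : Vec ℕ k) → rep (Vec.map (_mod M) y) ≡ Vec.map (_% M) y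
rep-mod M y = trans (sym (map-∘ toℕ (_mod M) y)) (map-cong (λ v → toℕ-fromℕ< (m%n<n v M)) y)

split-mod : ∀ M .{{_ : NonZero M}} {k} (y : Vec ℕ k) → y ≡ Vec.map (_% M) y +ᵥ M *ᵥ Vec.map (_div M) y
split-mod M []      = refl
split-mod M (v ∷ y) =
  cong₂ _∷_ (trans (m≡m%n+[m/n]*n v M) (cong (λ t → v % M + t) (*-comm (v div M) M))) (split-mod M y)

^-distribʳ-* : ∀ m n k → (m * n) ^ k ≡ m ^ k * n ^ k
^-distribʳ-* m n zero    = refl
^-distribʳ-* m n (suc k) = trans (cong (m * n *_) (^-distribʳ-* m n k)) (identity m n (m ^ k) (n ^ k))
  where identity : ∀ m n M N → m * n * (M * N) ≡ m * M * (n * N)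
        identity = solve-∀

power-split : ∀ p {m r} n → m ≤ r → (p ^ r) ^ n ≡ (p ^ (r ∸ m)) ^ n * p ^ (m * n)
power-split p {m} {r} n m≤r = begin
  (p ^ r) ^ n                     ≡⟨ cong (λ t → (p ^ t) ^ n) (m∸n+n≡m m≤r) ⟨
  (p ^ (r ∸ m + m)) ^ n           ≡⟨ cong (_^ n) (^-distribˡ-+-* p (r ∸ m) m) ⟩
  (p ^ (r ∸ m) * p ^ m) ^ n       ≡⟨ ^-distribʳ-* (p ^ (r ∸ m)) (p ^ m) n ⟩
  (p ^ (r ∸ m)) ^ n * (p ^ m) ^ n ≡⟨ cong ((p ^ (r ∸ m)) ^ n *_) (^-*-assoc p m n) ⟩
  (p ^ (r ∸ m)) ^ n * p ^ (m * n) ∎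
  where open ≡-Reasoning

fraction-≤ : ∀ a b c d .{{_ : NonZero b}} .{{_ : NonZero d}} → a * d ≤ c * b → (+ a / b) ℚ.≤ (+ c / d)
fraction-≤ a (suc b) c (suc d) ad≤cb = toℚᵘ-cancel-≤
  (ℚᵘ.≤-respˡ-≃ (ℚᵘ.≃-sym (toℚᵘ-fromℚᵘ (mkℚᵘ (+ a) b)))
    (ℚᵘ.≤-respʳ-≃ (ℚᵘ.≃-sym (toℚᵘ-fromℚᵘ (mkℚᵘ (+ c) d)))
      (*≤* (subst₂ ℤ._≤_ (ℤ.pos-* a (suc d)) (ℤ.pos-* c (suc b)) (ℤ.+≤+ ad≤cb)))))

solutionCount : (Q d n : ℕ) → Vec (Fin Q) (N d n) → ℕ
solutionCount Q d n a = length (filter (λ b → InR? b ×-dec (Q ∣? form d n a (rep b))) (allVecs Q (suc n)))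

σ-≥ : ∀ Q .{{_ : NonZero Q}} d n (a : Vec (Fin Q) (N d n)) {C} D .{{_ : NonZero D}} →
      C ≤ solutionCount Q d n a → Q ^ n ≤ C * D → σ Q d n a ≥ (+ 1 / D)
σ-≥ Q d n a {C} D C≤ Qⁿ≤CD = fraction-≤ 1 D (solutionCount Q d n a) (Q ^ n)
  (≤-trans (≤-reflexive (*-identityˡ (Q ^ n))) (≤-trans Qⁿ≤CD (*-monoˡ-≤ D C≤)))
  where instance Qⁿ≢0 = m^n≢0 Q n

root-count : ∀ {Q d n} (a : Vec (Fin Q) (N d n)) {x : Vec (Fin Q) (suc n)} →
             InR x → Q ∣ form d n a (rep x) → 1 ≤ solutionCount Q d n a
root-count {Q} {n = n} a {x} x-primitive root = injection-count _ (λ (_ : ⊤) → x) (λ _ → refl)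
  (λ _ → x-primitive , root) (ListAll.[] ∷ []) (allVecs Q (suc n)) (allVecs-complete Q)

module _ {d n p r e : ℕ} (p-prime : Prime p) (a : Vec (Fin (p ^ r)) (N d n))
         {x : Vec (Fin (p ^ r)) (suc n)} (x-primitive : InR x) (root : p ^ r ∣ form d n a (rep x))
         (p^e∣∂ : ∀ j → p ^ e ∣ lookup (grad d n a (rep x)) j)
         {j₀ : Fin (suc n)} (p^[1+e]∤∂ : ¬ p ^ suc e ∣ lookup (grad d n a (rep x)) j₀) (e<r : e < r) where

  private
    M q P : ℕ
    M = p ^ r
    q = p ^ suc e
    P = p ^ (r ∸ suc e)

    instance
      M≢0 : NonZero M
      M≢0 = powNZ p-prime r
      q≢0 : NonZero q
      q≢0 = powNZ p-prime (suc e)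

    q*P≡M : q * P ≡ M
    q*P≡M = trans (sym (^-distribˡ-+-* p (suc e) (r ∸ suc e))) (cong (p ^_) (m+[n∸m]≡n e<r))

    prescribed : Vec (Fin P) n → Fin n → ℕ
    prescribed σ i = offset q P (lookup (rep x) (punchIn j₀ i)) (toℕ (lookup σ i))

    lifted : (σ : Vec (Fin P) n) →
      ∃[ W ] (∀ i → lookup W (punchIn j₀ i) ≡ prescribed σ i) × M ∣ form d n a (rep x +ᵥ q *ᵥ W)
    lifted σ = hensel-lift d n a p-prime {r} {e} root p^e∣∂ {j₀} p^[1+e]∤∂ (prescribed σ)

    lift : Vec (Fin P) n → Vec ℕ (suc n)
    lift σ = proj₁ (lifted σ)

    lift-agrees : ∀ σ i → lookup (lift σ) (punchIn j₀ i) ≡ prescribed σ i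
    lift-agrees σ = proj₁ (proj₂ (lifted σ))

    point : Vec (Fin P) n → Vec ℕ (suc n)
    point σ = rep x +ᵥ q *ᵥ lift σ

    point-root : ∀ σ → M ∣ form d n a (point σ)
    point-root σ = proj₂ (proj₂ (lifted σ))

  solution : Vec (Fin P) n → Vec (Fin M) (suc n)
  solution σ = Vec.map (_mod M) (point σ)

  solution-primitive : ∀ σ → InR (solution σ)
  solution-primitive σ = subst (λ v → List.foldr gcd M (toList v) ≡ 1) (sym (rep-mod M (point σ)))
    (Equivalence.from (primitive⇔ p-prime 1≤r (Vec.map (_% M) (point σ)))
      (Equivalence.to (primitive⇔ p-prime 1≤r (rep x)) x-primitive
        ∘ All-∣-translate-mod p∣q (∣-trans p∣q q∣M) (rep x) (lift σ)))
    where
    1≤r = ≤-trans (s≤s z≤n) e<r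
    p∣q = m∣m*n (p ^ e)
    q∣M = subst (q ∣_) q*P≡M (m∣m*n P)

  solution-root : ∀ σ → M ∣ form d n a (rep (solution σ))
  solution-root σ = subst (λ v → M ∣ form d n a v) (sym (rep-mod M (point σ)))
    (shift-∣⇐ reduction ∣-refl (point-root σ))
    where
    reduction : Shift M (form d n a (point σ)) (form d n a (Vec.map (_% M) (point σ)))
    reduction = subst (λ y → Shift M (form d n a y) (form d n a (Vec.map (_% M) (point σ))))
      (sym (split-mod M (point σ))) (form-shift d n a M (Vec.map (_% M) (point σ)) (Vec.map (_div M) (point σ)))

  solution-decode : ∀ σ i → toℕ (lookup (solution σ) (punchIn j₀ i)) div q ≡ toℕ (lookup σ i)
  solution-decode σ i = begin
    toℕ (lookup (solution σ) j) div q                        ≡⟨ cong (λ b → toℕ b div q) (lookup-map j (_mod M) (point σ)) ⟩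
    toℕ (lookup (point σ) j mod M) div q                     ≡⟨ cong (_div q) (toℕ-fromℕ< (m%n<n (lookup (point σ) j) M)) ⟩
    (lookup (point σ) j % M) div q                           ≡⟨ cong (λ v → (v % M) div q) point-coordinate ⟩
    ((xⱼ + q * offset q P xⱼ (toℕ (lookup σ i))) % M) div q  ≡⟨ offset-decode q P M q*P≡M xⱼ<M (toℕ<n (lookup σ i)) ⟩
    toℕ (lookup σ i)                                         ∎
    where
    open ≡-Reasoning
    j = punchIn j₀ i
    xⱼ = lookup (rep x) j
    xⱼ<M : xⱼ < M
    xⱼ<M = subst (_< M) (sym (lookup-map j toℕ x)) (toℕ<n (lookup x j))
    point-coordinate : lookup (point σ) j ≡ xⱼ + q * offset q P xⱼ (toℕ (lookup σ i))
    point-coordinate = begin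
      lookup (point σ) j           ≡⟨ lookup-zipWith _+_ j (rep x) (q *ᵥ lift σ) ⟩
      xⱼ + lookup (q *ᵥ lift σ) j  ≡⟨ cong (λ t → xⱼ + t) (lookup-map j (q *_) (lift σ)) ⟩
      xⱼ + q * lookup (lift σ) j   ≡⟨ cong (λ t → xⱼ + q * t) (lift-agrees σ i) ⟩
      xⱼ + q * prescribed σ i      ∎

  solution-injective : ∀ {σ σ′} → solution σ ≡ solution σ′ → σ ≡ σ′
  solution-injective {σ} {σ′} eq = begin
    σ                    ≡⟨ tabulate∘lookup σ ⟨
    tabulate (lookup σ)  ≡⟨ tabulate-cong (λ i → toℕ-injective (begin
      toℕ (lookup σ i)                                 ≡⟨ solution-decode σ i ⟨
      toℕ (lookup (solution σ) (punchIn j₀ i)) div q   ≡⟨ cong (λ b → toℕ (lookup b (punchIn j₀ i)) div q) eq ⟩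
      toℕ (lookup (solution σ′) (punchIn j₀ i)) div q  ≡⟨ solution-decode σ′ i ⟩
      toℕ (lookup σ′ i)                                ∎)) ⟩
    tabulate (lookup σ′) ≡⟨ tabulate∘lookup σ′ ⟩
    σ′                   ∎
    where open ≡-Reasoning

  solution-count : P ^ n ≤ solutionCount M d n a
  solution-count = subst (_≤ solutionCount M d n a) (length-allVecs P n)
    (injection-count _ solution solution-injective (λ σ → solution-primitive σ , solution-root σ)
      (allVecs-unique P n) (allVecs M (suc n)) (allVecs-complete M))

lemma5p7 : (d n p r e : ℕ) → 2 ≤ d → 3 ≤ n → (pp : Prime p) → 1 ≤ r → e ≤ r →
    (a : Vec (Fin (p ^ r)) (N d n)) → InRe p r e d n a →
    σ (p ^ r) {{powNZ pp r}} d n a ≥ ((+ 1) / (p ^ (suc e * n))) {{powNZ pp (suc e * n)}}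
lemma5p7 d n p r e _ _ pp _ e≤r a (_ , x , x-primitive , root , _ , p^e∣∂ , p^[1+e]∤∇) =
  [ valuation-below-r , valuation-r ]′ (m≤n⇒m<n∨m≡n e≤r)
  where
  instance
    _ = powNZ pp r
    _ = prime⇒nonZero pp

  valuation-below-r : e < r → σ (p ^ r) d n a ≥ ((+ 1) / (p ^ (suc e * n))) {{powNZ pp (suc e * n)}}
  valuation-below-r e<r = σ-≥ (p ^ r) d n a (p ^ (suc e * n)) {{powNZ pp (suc e * n)}}
    (solution-count {d} {n} {p} {r} {e} pp a {x} x-primitive root (lookup⁺ p^e∣∂) {proj₁ j₀} (proj₂ j₀) e<r)
    (≤-reflexive (power-split p n e<r))
    where
    j₀ : ∃[ j ] ¬ p ^ suc e ∣ lookup (grad d n a (rep x)) j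
    j₀ = ¬∀⟶∃¬ (suc n) _ (λ j → p ^ suc e ∣? lookup (grad d n a (rep x)) j) (p^[1+e]∤∇ e<r ∘ lookup⁻)

  valuation-r : e ≡ r → σ (p ^ r) d n a ≥ ((+ 1) / (p ^ (suc e * n))) {{powNZ pp (suc e * n)}}
  valuation-r refl = σ-≥ (p ^ r) d n a (p ^ (suc r * n)) {{powNZ pp (suc r * n)}} (root-count {d = d} a {x} x-primitive root)
    (≤-trans (^-monoˡ-≤ n (m≤n*m (p ^ r) p)) (≤-reflexive (trans (^-*-assoc p (suc r) n) (sym (*-identityˡ _)))))
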